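{- Let $L$ be an $\alpha$-sorted lattice data structure of height $h$. If the procedure $P$ performing each jump step of JumpSearchLDS runs in time $O(t_P(m))$ on $m$ elements, then JumpSearchLDS on $L$ runs in time $O(\max\{4,\,2h-2\alpha+2\}\,t_P(h))$.
   Context: Diagram of height $h$: cells $(r,c)$ of positive integers with $r+c\le h+4$; $r$ is the row (numbered bottom to top), $c$ the column (left to right). Diagonal $k$ ($1\le k\le h+3$) is the set of cells with $r+c=k+1$, numbered from head $(k,1)$ to tail $(1,k)$, its $j$-th cell being $(k+1-j,j)$. A lattice data structure (LDS) of height $h$ assigns to each cell an entry in $\{0,\infty\}\cup\mathbb{Z}_{>0}$ such that: (1) all cells of row $1$ and column $1$ contain $0$; (2) all cells of diagonal $h+3$ except head and tail contain $\infty$; (3) for some $0\le m\le h-1$, exactly the cells $(h+3-j,j)$ of diagonal $h+2$ with $h+2-m\le j\le h+1$ contain $\infty$; (4) all remaining cells contain pairwise distinct positive integers (proper keys); (5) proper keys are strictly increasing along each row (left to right), column (bottom to top) and diagonal (head to tail). Order convention: $0<n<\infty$. For $\alpha\in\{3,\dots,h\}$, $L$ is $\alpha$-sorted if for every $s$ with $4\le s\le\alpha+2$, the first proper key of diagonal $s$ (counting from the head) is greater than the last proper key of diagonal $s-1$. JumpSearchLDS($L,K$) for a positive integer $K$: start at $C=(h+1,2)$; while the entry of $C$ is neither $K$ nor $0$: if $K<C$ (downward jump), move $C$ down its column to the first cell (going downward) with entry $\le K$; otherwise (diagonal jump), move $C$ along its diagonal toward the tail to the first cell with entry $\ge K$,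 or to a cell with entry $0$ if there is none. Report present iff the final entry is $K$. Each jump is carried out by a procedure $P$ applied to the relevant sorted part of the current column or diagonal. -}

module Defs where

open import Data.Nat using (ℕ; zero; suc; _+_; _*_; _∸_; _≤_; _<_; _⊔_)
open import Data.Product using (Σ; ∃; _×_; _,_)
open import Data.Sum using (_⊎_)
open import Relation.Nullary using (¬_)
open import Relation.Binary.PropositionalEquality using (_≡_; _≢_)

-- Entries of a lattice data structure: 0, ∞ or a positive integer.
-- `fin 0` is the entry 0, `fin (suc n)` is the proper key suc n.

data Ent : Set where
  fin : ℕ → Ent
  ∞   : Ent

data _<ᴱ_ : Ent → Ent → Set where
  fin<fin : ∀ {m n} → m < n → fin m <ᴱ fin n
  fin<∞   : ∀ {m} → fin m <ᴱ ∞

_≤ᴱ_ : Ent → Ent → Set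
a ≤ᴱ b = a <ᴱ b ⊎ a ≡ b

-- An LDS is an assignment of entries to cells (r , c); only the cells
-- of the diagram are constrained.
Assignment : Set
Assignment = ℕ → ℕ → Ent

InDiagram : ℕ → ℕ → ℕ → Set
InDiagram h r c = 1 ≤ r × 1 ≤ c × r + c ≤ h + 4

IsProper : Ent → Set
IsProper e = Σ ℕ λ n → e ≡ fin (suc n)

-- the ∞-pattern on diagonal h+2 (condition (3)) for parameter m:
-- cell (h+3-j, j) with 2 ≤ j ≤ h+1 contains ∞ iff h+2-m ≤ j
Diag2Infty : ℕ → ℕ → ℕ → Set
Diag2Infty h m j = (h + 2) ∸ m ≤ j × j ≤ h + 1

record IsLDS (h : ℕ) (L : Assignment) : Set where
  field
    row1 : ∀ c → InDiagram h 1 c → L 1 c ≡ fin 0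
    col1 : ∀ r → InDiagram h r 1 → L r 1 ≡ fin 0
    diag3 : ∀ j → 2 ≤ j → j ≤ h + 2 → L ((h + 4) ∸ j) j ≡ ∞
    m    : ℕ
    m<h  : m < h
    diag2∞ : ∀ j → 2 ≤ j → j ≤ h + 1 → Diag2Infty h m j → L ((h + 3) ∸ j) j ≡ ∞
    proper : ∀ r c → 2 ≤ r → 2 ≤ c → r + c ≤ h + 3 →
             ¬ (r + c ≡ h + 3 × Diag2Infty h m c) → IsProper (L r c)
    distinct : ∀ r c r' c' → InDiagram h r c → InDiagram h r' c' →
               IsProper (L r c) → L r c ≡ L r' c' → (r ≡ r' × c ≡ c')
    rowInc : ∀ r c c' → InDiagram h r c' → c < c' →
             IsProper (L r c) → IsProper (L r c') → L r c <ᴱ L r c'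
    colInc : ∀ r r' c → InDiagram h r' c → r < r' →
             IsProper (L r c) → IsProper (L r' c) → L r c <ᴱ L r' c
    -- diagonal order head → tail: column index increases
    diagInc : ∀ r c r' c' → InDiagram h r c → InDiagram h r' c' →
              r + c ≡ r' + c' → c < c' →
              IsProper (L r c) → IsProper (L r' c') → L r c <ᴱ L r' c'

-- the j-th cell of diagonal k is (k+1-j, j), 1 ≤ j ≤ k
-- v is the first proper key (counting from the head) of diagonal k
FirstProperKey : Assignment → ℕ → ℕ → Set
FirstProperKey L k v =
  Σ ℕ λ j → 1 ≤ j × j ≤ k × L ((k + 1) ∸ j) j ≡ fin (suc v) ×
    (∀ j' → 1 ≤ j' → j' < j → ¬ IsProper (L ((k + 1) ∸ j') j'))

LastProperKey : Assignment → ℕ → ℕ → Set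
LastProperKey L k v =
  Σ ℕ λ j → 1 ≤ j × j ≤ k × L ((k + 1) ∸ j) j ≡ fin (suc v) ×
    (∀ j' → j < j' → j' ≤ k → ¬ IsProper (L ((k + 1) ∸ j') j'))

AlphaSorted : ℕ → Assignment → Set
AlphaSorted α L = ∀ s → 4 ≤ s → s ≤ α + 2 → ∀ u v →
  FirstProperKey L s u → LastProperKey L (s ∸ 1) v → v < u

_<ₖ_ : ℕ → Ent → Set
K <ₖ e = fin K <ᴱ e

_≤ₖ_ : Ent → ℕ → Set
e ≤ₖ K = e ≤ᴱ fin K

-- JumpSearchLDS with a cost model.
-- `T m` is the running time of the jump procedure P on a sorted part of
-- m elements.  A jump from the current cell C = (r , c) (downward along
-- column c, or along the diagonal of C toward the tail) is applied to the
-- r ∸ 2 cells strictly between C and the bottom row / the tail, and costs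
-- T (r ∸ 2) plus one unit of bookkeeping; the final test costs one unit.
-- `Run T L K r c t` : started at (r , c), the search terminates and its
-- total running time is t.

data Run (T : ℕ → ℕ) (L : Assignment) (K : ℕ) : ℕ → ℕ → ℕ → Set where
  stopK : ∀ {r c} → L r c ≡ fin K → Run T L K r c 1
  stop0 : ∀ {r c} → L r c ≡ fin 0 → Run T L K r c 1
  down  : ∀ {r c r' t} → K <ₖ L r c →
          r' < r → L r' c ≤ₖ K →
          (∀ r'' → r' < r'' → r'' < r → ¬ (L r'' c ≤ₖ K)) →
          Run T L K r' c t →
          Run T L K r c (suc (T (r ∸ 2) + t))
  diag  : ∀ {r c n i t} → L r c ≡ fin (suc n) → suc n < K →
          1 ≤ i → i < r →
          (K <ₖ L (r ∸ i) (c + i) ⊎ L (r ∸ i) (c + i) ≡ fin K ⊎ L (r ∸ i) (c + i) ≡ fin 0) →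
          (∀ i' → 1 ≤ i' → i' < i →
             ¬ (K <ₖ L (r ∸ i') (c + i') ⊎ L (r ∸ i') (c + i') ≡ fin K ⊎ L (r ∸ i') (c + i') ≡ fin 0)) →
          Run T L K (r ∸ i) (c + i) t →
          Run T L K r c (suc (T (r ∸ 2) + t))

RunsInTime : (ℕ → ℕ) → ℕ → Assignment → ℕ → ℕ → Set
RunsInTime T h L K t = Run T L K (h + 1) 2 t

BigO : (ℕ → ℕ) → (ℕ → ℕ) → Set
BigO f g = Σ ℕ λ C → Σ ℕ λ N → ∀ m → N ≤ m → f m ≤ C * g m

-- Each jump acts on at
-- most h cells and is charged one budget U ≥ 1 + T m (m ≤ h); we count jumps.
--  * Geometry: row 1 and column 1 hold 0, cells below diagonal h+2 and in
--    column 2 hold proper keys, and each proper key lies between the head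
--    (column 2) and the tail (row 2) of its diagonal.
--  * α-sortedness makes each tail smaller than the next head, so in the
--    sorted region (r + c ≤ α + 3) keys on lower diagonals are smaller.
--  * Jumps always exist; downward jumps lower the diagonal, diagonal jumps
--    keep it.  In the sorted region at most 5 jumps are needed: after a
--    diagonal and a downward jump the search sits on a key below K whose
--    tailward diagonal lies below the current key, so the next diagonal jump
--    halts.  Above the sorted region every two jumps lower the diagonal.
--  * From (h+1, 2) this gives 2(h - α) + 5 ≤ 2 max{4, 2h - 2α + 2} jumps, and
--    since tP ≥ 1 the big-O bound on T becomes a uniform constant times tP.
module Submission where

open import Defs
open import Data.Nat using (ℕ; zero; suc; _+_; _*_; _∸_; _≤_; _<_; _⊔_; z≤n; s≤s; _≟_; _<?_; <-cmp)
open import Data.Nat.Properties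
open import Data.Nat.Tactic.RingSolver using (solve-∀)
open import Data.Product using (Σ; _×_; _,_)
open import Data.Sum using (_⊎_; inj₁; inj₂)
open import Function using (_∘_)
open import Relation.Nullary using (¬_; Dec; yes; no; contradiction)
open import Relation.Nullary.Decidable using (_⊎-dec_; map′)
open import Relation.Unary using (Decidable)
open import Relation.Binary using (tri<; tri≈; tri>)
open import Relation.Binary.PropositionalEquality using (_≡_; refl; sym; trans; cong; subst; module ≡-Reasoning)

leastWitness : (Q : ℕ → Set) → Decidable Q → ∀ n → Q n →
  Σ ℕ λ k → k ≤ n × Q k × (∀ k' → k' < k → ¬ Q k')
leastWitness Q dec n q with dec 0
... | yes q0 = 0 , z≤n , q0 , λ _ ()
leastWitness Q dec zero q | no ¬q0 = contradiction q ¬q0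
leastWitness Q dec (suc n) q | no ¬q0 with leastWitness (Q ∘ suc) (dec ∘ suc) n q
... | k , k≤n , qk , before = suc k , s≤s k≤n , qk , earlier
  where
  earlier : ∀ k' → k' < suc k → ¬ Q k'
  earlier zero _ = ¬q0
  earlier (suc k') (s≤s k'<k) = before k' k'<k

greatestBelow : (P : ℕ → Set) → Decidable P → ∀ {b} r → P b → b < r →
  Σ ℕ λ r' → b ≤ r' × r' < r × P r' × (∀ r'' → r' < r'' → r'' < r → ¬ P r'')
greatestBelow P dec {b} (suc r) pb (s≤s b≤r) with dec r
... | yes pr = r , b≤r , ≤-refl , pr , λ r'' r<r'' r''<1+r _ → ≤⇒≯ (m<1+n⇒m≤n r''<1+r) r<r''
... | no ¬pr with greatestBelow P dec r pb (≤∧≢⇒< b≤r λ { refl → ¬pr pb })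
... | r' , b≤r' , r'<r , pr' , after = r' , b≤r' , m<n⇒m<1+n r'<r , pr' , later
  where
  later : ∀ r'' → r' < r'' → r'' < suc r → ¬ P r''
  later r'' r'<r'' r''<1+r with m≤n⇒m<n∨m≡n (m<1+n⇒m≤n r''<1+r)
  ... | inj₁ r''<r = after r'' r'<r'' r''<r
  ... | inj₂ refl = ¬pr

shiftedBound : ∀ k {a b} → a ≤ b → k + a ≤ b + k
shiftedBound k {a} a≤b = ≤-trans (≤-reflexive (+-comm k a)) (+-monoˡ-≤ k a≤b)

fin-injective : ∀ {m n} → fin m ≡ fin n → m ≡ n
fin-injective refl = refl

_≟ᴱ_ : (a b : Ent) → Dec (a ≡ b)
fin m ≟ᴱ fin n = map′ (cong fin) fin-injective (m ≟ n)
fin _ ≟ᴱ ∞     = no λ ()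
∞     ≟ᴱ fin _ = no λ ()
∞     ≟ᴱ ∞     = yes refl

_<ᴱ?_ : (a b : Ent) → Dec (a <ᴱ b)
fin m <ᴱ? fin n = map′ fin<fin (λ { (fin<fin m<n) → m<n }) (m <? n)
fin _ <ᴱ? ∞     = yes fin<∞
∞     <ᴱ? _     = no λ ()

_≤ᴱ?_ : (a b : Ent) → Dec (a ≤ᴱ b)
a ≤ᴱ? b = (a <ᴱ? b) ⊎-dec (a ≟ᴱ b)

<ᴱ-irrefl : ∀ {a} → ¬ (a <ᴱ a)
<ᴱ-irrefl (fin<fin n<n) = <-irrefl refl n<n

<ᴱ-trans : ∀ {a b c} → a <ᴱ b → b <ᴱ c → a <ᴱ c
<ᴱ-trans (fin<fin p) (fin<fin q) = fin<fin (<-trans p q)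
<ᴱ-trans (fin<fin _) fin<∞       = fin<∞

≤ᴱ-<ᴱ-trans : ∀ {a b c} → a ≤ᴱ b → b <ᴱ c → a <ᴱ c
≤ᴱ-<ᴱ-trans (inj₁ a<b)  b<c = <ᴱ-trans a<b b<c
≤ᴱ-<ᴱ-trans (inj₂ refl) b<c = b<c

<ᴱ-≤ᴱ-trans : ∀ {a b c} → a <ᴱ b → b ≤ᴱ c → a <ᴱ c
<ᴱ-≤ᴱ-trans a<b (inj₁ b<c)  = <ᴱ-trans a<b b<c
<ᴱ-≤ᴱ-trans a<b (inj₂ refl) = a<b

keys< : ∀ {a b u v} → a ≡ fin (suc u) → b ≡ fin (suc v) → u < v → a <ᴱ b
keys< refl refl u<v = fin<fin (s≤s u<v)

data Position (K : ℕ) (e : Ent) : Set where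
  atZero : e ≡ fin 0 → Position K e
  atKey  : e ≡ fin K → Position K e
  above  : K <ₖ e → Position K e
  below  : ∀ {n} → e ≡ fin (suc n) → suc n < K → Position K e

position : ∀ K e → Position K e
position K (fin zero) = atZero refl
position K (fin (suc n)) with <-cmp (suc n) K
... | tri< n<K _ _ = below refl n<K
... | tri≈ _ refl _ = atKey refl
... | tri> _ _ K<n = above (fin<fin K<n)
position K ∞ = above fin<∞

notAboveZero : ∀ {K e} → e ≡ fin 0 → ¬ (K <ₖ e)
notAboveZero refl (fin<fin ())

notAboveLanded : ∀ {K e} → e ≤ₖ K → ¬ (K <ₖ e)
notAboveLanded (inj₁ e<K)  K<e = <ᴱ-irrefl (<ᴱ-trans e<K K<e)
notAboveLanded (inj₂ refl) K<K = <ᴱ-irrefl K<K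

module Geometry {h : ℕ} {L : Assignment} (isL : IsLDS h L) where
  open IsLDS isL

  h+2<h+3 : h + 2 < h + 3
  h+2<h+3 = +-monoʳ-< h ≤-refl

  inDiagram : ∀ {r c} → 1 ≤ r → 1 ≤ c → r + c ≤ h + 3 → InDiagram h r c
  inDiagram 1≤r 1≤c le = 1≤r , 1≤c , ≤-trans le (+-monoʳ-≤ h (n≤1+n 3))

  bottomZero : ∀ {c} → 1 ≤ c → 1 + c ≤ h + 3 → L 1 c ≡ fin 0
  bottomZero 1≤c le = row1 _ (inDiagram ≤-refl 1≤c le)

  zeroNotProper : ∀ {e} → e ≡ fin 0 → ¬ IsProper e
  zeroNotProper refl (_ , ())

  interiorProper : ∀ {r c} → 2 ≤ r → 2 ≤ c → r + c ≤ h + 2 → IsProper (L r c)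
  interiorProper {r} {c} 2≤r 2≤c le = proper r c 2≤r 2≤c (<⇒≤ (≤-<-trans le h+2<h+3)) offLastDiagonal
    where
    offLastDiagonal : ¬ (r + c ≡ h + 3 × Diag2Infty h m c)
    offLastDiagonal (onIt , _) = <⇒≱ h+2<h+3 (subst (_≤ h + 2) onIt le)

  -- column 2 is proper up to diagonal h+2, since the ∞'s of condition (3)
  -- begin at column h + 2 - m ≥ 3 (because m < h)
  column2Proper : ∀ {r} → 2 ≤ r → r + 2 ≤ h + 3 → IsProper (L r 2)
  column2Proper {r} 2≤r le = proper r 2 2≤r ≤-refl le noInfinity
    where
    open ≤-Reasoning
    firstInfinityColumn : 3 ≤ (h + 2) ∸ m
    firstInfinityColumn = begin
      3               ≤⟨ +-monoˡ-≤ 2 (m<n⇒0<n∸m m<h) ⟩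
      (h ∸ m) + 2     ≡⟨ sym (+-∸-comm 2 (<⇒≤ m<h)) ⟩
      (h + 2) ∸ m     ∎
    noInfinity : ¬ (r + 2 ≡ h + 3 × Diag2Infty h m 2)
    noInfinity (_ , start≤2 , _) with ≤-trans firstInfinityColumn start≤2
    ... | s≤s (s≤s ())

  properOffBottom : ∀ {r c} → 1 ≤ r → 1 ≤ c → r + c ≤ h + 3 → IsProper (L r c) → 2 ≤ r
  properOffBottom {suc zero}    _ 1≤c le p = contradiction p (zeroNotProper (bottomZero 1≤c le))
  properOffBottom {suc (suc _)} _ _   _  _ = s≤s (s≤s z≤n)

  lowEntry : ∀ {r c} → 1 ≤ r → 2 ≤ c → r + c ≤ h + 2 → L r c ≡ fin 0 ⊎ IsProper (L r c)
  lowEntry {suc zero}    _ 2≤c le = inj₁ (bottomZero (≤-trans (n≤1+n 1) 2≤c) (<⇒≤ (≤-<-trans le h+2<h+3)))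
  lowEntry {suc (suc _)} _ 2≤c le = inj₂ (interiorProper (s≤s (s≤s z≤n)) 2≤c le)

  diagMono : ∀ {r c r' c'} → InDiagram h r c → InDiagram h r' c' → r + c ≡ r' + c' → c ≤ c' →
             IsProper (L r c) → IsProper (L r' c') → L r c ≤ᴱ L r' c'
  diagMono {r} {c} {r'} d d' sameDiagonal c≤c' p p' with m≤n⇒m<n∨m≡n c≤c'
  ... | inj₁ c<c' = inj₁ (diagInc _ _ _ _ d d' sameDiagonal c<c' p p')
  ... | inj₂ refl with +-cancelʳ-≡ c r r' sameDiagonal
  ... | refl = inj₂ refl

  aboveHead : ∀ {r y} → 1 ≤ r → r + (2 + y) ≤ h + 3 → IsProper (L r (2 + y)) → L (r + y) 2 ≤ᴱ L r (2 + y)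
  aboveHead {r} {y} 1≤r le p =
    diagMono (inDiagram (≤-trans (s≤s z≤n) 2≤r+y) (s≤s z≤n) headLe) (inDiagram 1≤r (s≤s z≤n) le)
      sameDiagonal (s≤s (s≤s z≤n)) (column2Proper 2≤r+y headLe) p
    where
    sameDiagonal : r + y + 2 ≡ r + (2 + y)
    sameDiagonal = trans (+-assoc r y 2) (cong (r +_) (+-comm y 2))
    headLe : r + y + 2 ≤ h + 3
    headLe = ≤-trans (≤-reflexive sameDiagonal) le
    2≤r+y : 2 ≤ r + y
    2≤r+y = ≤-trans (properOffBottom 1≤r (s≤s z≤n) le p) (m≤m+n r y)

  belowTail : ∀ {x c} → 2 ≤ c → 2 + x + c ≤ h + 2 → IsProper (L (2 + x) c) → L (2 + x) c ≤ᴱ L 2 (x + c)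
  belowTail {x} {c} 2≤c le p =
    diagMono (inDiagram (s≤s z≤n) 1≤c le') (inDiagram (s≤s z≤n) (≤-trans 1≤c (m≤n+m c x)) le')
      refl (m≤n+m c x) p (interiorProper ≤-refl (≤-trans 2≤c (m≤n+m c x)) le)
    where
    1≤c = ≤-trans (n≤1+n 1) 2≤c
    le' = <⇒≤ (≤-<-trans le h+2<h+3)

  onDiagonal : ∀ k {r j} → r + j ≡ k + 1 → L ((k + 1) ∸ j) j ≡ L r j
  onDiagonal k {r} {j} eq = cong (λ row → L row j) (trans (cong (_∸ j) (sym eq)) (m+n∸n≡m r j))

  headIsFirst : ∀ {r u} → 1 ≤ r → r + 2 ≤ h + 3 → L r 2 ≡ fin (suc u) → FirstProperKey L (suc r) u
  headIsFirst {r} 1≤r le key = 2 , s≤s z≤n , s≤s 1≤r , trans (onDiagonal (suc r) (+-suc r 1)) key , column1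
    where
    column1 : ∀ j → 1 ≤ j → j < 2 → ¬ IsProper (L ((suc r + 1) ∸ j) j)
    column1 (suc zero) _ _ = zeroNotProper
      (col1 _ (inDiagram (≤-trans 1≤r (m≤m+n r 1)) ≤-refl (≤-trans (≤-reflexive (+-assoc r 1 1)) le)))
    column1 (suc (suc _)) _ (s≤s (s≤s ()))

  tailIsLast : ∀ {c v} → 1 ≤ c → 2 + c ≤ h + 3 → L 2 c ≡ fin (suc v) → LastProperKey L (suc c) v
  tailIsLast {c} 1≤c le key = c , 1≤c , n≤1+n c , trans (onDiagonal (suc c) sameDiagonal) key , row1Cell
    where
    sameDiagonal : 2 + c ≡ suc c + 1
    sameDiagonal = cong suc (+-comm 1 c)
    row1Cell : ∀ j → c < j → j ≤ suc c → ¬ IsProper (L ((suc c + 1) ∸ j) j)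
    row1Cell j c<j j≤1+c with ≤-antisym j≤1+c c<j
    ... | refl = zeroNotProper (trans (onDiagonal (suc c) sameDiagonal) (bottomZero (s≤s z≤n) le))

module SortedDiagonals {h α : ℕ} {L : Assignment} (isL : IsLDS h L)
                       (sorted : AlphaSorted α L) (α≤h : α ≤ h) where
  open Geometry isL

  regionBound : ∀ {s} → s ≤ α + 3 → s ≤ h + 3
  regionBound le = ≤-trans le (+-monoˡ-≤ 3 α≤h)

  lowerInRegion : ∀ {s s'} → s < s' → s' ≤ α + 3 → s ≤ h + 2
  lowerInRegion s<s' le = ≤-pred (≤-trans s<s' (≤-trans (regionBound le) (≤-reflexive (+-suc h 2))))

  sortedStep : ∀ {a} → 2 ≤ a → a ≤ α → L 2 a <ᴱ L (suc a) 2
  sortedStep {a} 2≤a a≤α = compareKeys (interiorProper ≤-refl 2≤a tailLe) (column2Proper (s≤s 1≤a) headLe)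
    where
    1≤a = ≤-trans (n≤1+n 1) 2≤a
    tailLe : 2 + a ≤ h + 2
    tailLe = shiftedBound 2 (≤-trans a≤α α≤h)
    headLe : suc a + 2 ≤ h + 3
    headLe = ≤-trans (≤-reflexive (+-comm (suc a) 2)) (shiftedBound 3 (≤-trans a≤α α≤h))
    compareKeys : IsProper (L 2 a) → IsProper (L (suc a) 2) → L 2 a <ᴱ L (suc a) 2
    compareKeys (v , tailKey) (u , headKey) =
      keys< tailKey headKey (sorted (2 + a) (s≤s (s≤s 2≤a)) (shiftedBound 2 a≤α) u v
        (headIsFirst (s≤s z≤n) headLe headKey) (tailIsLast 1≤a (<⇒≤ (≤-<-trans tailLe h+2<h+3)) tailKey))

  tailBelowHead : ∀ {a} b → 2 ≤ a → a < b → b ≤ suc α → L 2 a <ᴱ L b 2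
  tailBelowHead (suc b) 2≤a a<1+b 1+b≤ with m≤n⇒m<n∨m≡n (≤-pred a<1+b)
  ... | inj₂ refl = sortedStep 2≤a (≤-pred 1+b≤)
  ... | inj₁ a<b =
    <ᴱ-trans (<ᴱ-≤ᴱ-trans (tailBelowHead b 2≤a a<b (≤-trans (n≤1+n b) 1+b≤)) headBelowTail)
             (sortedStep 2≤b (≤-pred 1+b≤))
    where
    2≤b = ≤-trans 2≤a (<⇒≤ a<b)
    b≤h = ≤-trans (≤-pred 1+b≤) α≤h
    headLe : b + 2 ≤ h + 3
    headLe = ≤-trans (+-monoˡ-≤ 2 b≤h) (<⇒≤ h+2<h+3)
    headBelowTail : L b 2 ≤ᴱ L 2 b
    headBelowTail = diagMono (inDiagram (≤-trans (n≤1+n 1) 2≤b) (s≤s z≤n) headLe)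
      (inDiagram (s≤s z≤n) (≤-trans (n≤1+n 1) 2≤b) (≤-trans (≤-reflexive (+-comm 2 b)) headLe))
      (+-comm b 2) 2≤b (column2Proper 2≤b headLe) (interiorProper ≤-refl 2≤b (shiftedBound 2 b≤h))

  sortedKeys : ∀ {r₁ c₁ r₂ c₂} → 1 ≤ r₁ → 2 ≤ c₁ → 1 ≤ r₂ → 2 ≤ c₂ →
    r₁ + c₁ < r₂ + c₂ → r₂ + c₂ ≤ α + 3 →
    IsProper (L r₁ c₁) → IsProper (L r₂ c₂) → L r₁ c₁ <ᴱ L r₂ c₂
  sortedKeys {suc zero} _ 2≤c₁ _ _ lower inRegion p₁ _ =
    contradiction p₁ (zeroNotProper (bottomZero (≤-trans (n≤1+n 1) 2≤c₁)
      (<⇒≤ (≤-<-trans (lowerInRegion lower inRegion) h+2<h+3))))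
  sortedKeys {suc (suc _)} {c₂ = suc zero} _ _ _ (s≤s ()) _ _ _ _
  sortedKeys {suc (suc x)} {c₁} {r₂} {suc (suc y)} _ 2≤c₁ 1≤r₂ _ lower inRegion p₁ p₂ =
    ≤ᴱ-<ᴱ-trans (belowTail 2≤c₁ (lowerInRegion lower inRegion) p₁)
      (<ᴱ-≤ᴱ-trans (tailBelowHead (r₂ + y) (≤-trans 2≤c₁ (m≤n+m c₁ x)) tail<head head≤)
        (aboveHead 1≤r₂ (regionBound inRegion) p₂))
    where
    twoShift : r₂ + (2 + y) ≡ 2 + (r₂ + y)
    twoShift = trans (+-suc r₂ (suc y)) (cong suc (+-suc r₂ y))
    tail<head : x + c₁ < r₂ + y
    tail<head = ≤-pred (≤-pred (≤-trans lower (≤-reflexive twoShift)))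
    head≤ : r₂ + y ≤ suc α
    head≤ = ≤-pred (≤-pred (≤-trans (≤-reflexive (sym twoShift)) (≤-trans inRegion (≤-reflexive (+-comm α 3)))))

-- Jump count for a start d diagonals above the sorted region:
-- 5 inside the sorted region and 2 for every further diagonal
budget : ℕ → ℕ
budget zero    = 5
budget (suc d) = 2 + budget d

budget≤ : ∀ d → budget d ≤ 2 * (4 ⊔ (2 * d + 2))
budget≤ d = begin
  budget d             ≡⟨ closedForm d ⟩
  (2 * d + 2) + 3      ≤⟨ +-mono-≤ (m≤n⊔m 4 (2 * d + 2)) (≤-trans (n≤1+n 3) (m≤m⊔n 4 (2 * d + 2))) ⟩
  M + M                ≡⟨ cong (M +_) (sym (+-identityʳ M)) ⟩
  2 * M                ∎
  where
  open ≤-Reasoning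
  M = 4 ⊔ (2 * d + 2)
  closedForm : ∀ d → budget d ≡ (2 * d + 2) + 3
  closedForm zero    = refl
  closedForm (suc d) = trans (cong (2 +_) (closedForm d)) (cong (λ x → x + 2 + 3) (sym (*-suc 2 d)))

module JumpSearch (T : ℕ → ℕ) {h : ℕ} {L : Assignment} (isL : IsLDS h L) {K : ℕ} (1≤K : 1 ≤ K)
                  (U : ℕ) (jumpCost : ∀ m → m ≤ h → suc (T m) ≤ U) where
  open Geometry isL

  Cell : ℕ → ℕ → Set
  Cell r c = 1 ≤ r × 2 ≤ c × r + c ≤ h + 3

  -- the 0 below a visited cell stops every downward and diagonal jump
  bottomOf : ∀ {r c} → Cell r c → L 1 c ≡ fin 0
  bottomOf {r} {c} (1≤r , 2≤c , le) = bottomZero (≤-trans (n≤1+n 1) 2≤c) (≤-trans (+-monoˡ-≤ c 1≤r) le)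

  diagonalSum : ∀ r c {i} → i ≤ r → (r ∸ i) + (c + i) ≡ r + c
  diagonalSum r c {i} i≤r = begin
    (r ∸ i) + (c + i)  ≡⟨ cong ((r ∸ i) +_) (+-comm c i) ⟩
    (r ∸ i) + (i + c)  ≡⟨ sym (+-assoc (r ∸ i) i c) ⟩
    (r ∸ i + i) + c    ≡⟨ cong (_+ c) (m∸n+n≡m i≤r) ⟩
    r + c              ∎
    where open ≡-Reasoning

  alongDiagonal : ∀ {r c i} → Cell r c → i < r → Cell (r ∸ i) (c + i)
  alongDiagonal {r} {c} {i} (_ , 2≤c , le) i<r =
    m<n⇒0<n∸m i<r , ≤-trans 2≤c (m≤m+n c i) , ≤-trans (≤-reflexive (diagonalSum r c (<⇒≤ i<r))) le

  rowBound : ∀ {r c} → Cell r c → r ∸ 2 ≤ h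
  rowBound {r} {c} (_ , 2≤c , le) = m≤n+o⇒m∸n≤o r 2 (+-cancelʳ-≤ 2 r (2 + h) r+2≤)
    where
    open ≤-Reasoning
    r+2≤ : r + 2 ≤ 2 + h + 2
    r+2≤ = begin
      r + 2        ≤⟨ +-monoʳ-≤ r 2≤c ⟩
      r + c        ≤⟨ le ⟩
      h + 3        ≡⟨ +-suc h 2 ⟩
      suc (h + 2)  ≤⟨ n≤1+n _ ⟩
      2 + h + 2    ∎

  record DownJump (r c : ℕ) : Set where
    constructor downTo
    field
      target   : ℕ
      1≤target : 1 ≤ target
      target<r : target < r
      landed   : L target c ≤ₖ K
      skipped  : ∀ r'' → target < r'' → r'' < r → ¬ (L r'' c ≤ₖ K)
  open DownJump

  -- the downward jump exists: the 0 of row 1 is ≤ K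
  downJump : ∀ {r c} → Cell r c → K <ₖ L r c → DownJump r c
  downJump {suc zero} cell K<e = contradiction K<e (notAboveZero (bottomOf cell))
  downJump {suc (suc r)} {c} cell _
    with greatestBelow (λ row → L row c ≤ₖ K) (λ row → L row c ≤ᴱ? fin K) (suc (suc r))
           (inj₁ (subst (_<ᴱ fin K) (sym (bottomOf cell)) (fin<fin 1≤K))) (s≤s (s≤s z≤n))
  ... | row , 1≤row , row<r , lands , skips = downTo row 1≤row row<r lands skips

  downLowers : ∀ {r c} (J : DownJump r c) → target J + c < r + c
  downLowers {c = c} J = +-monoˡ-< c (target<r J)

  downCell : ∀ {r c} → Cell r c → (J : DownJump r c) → Cell (target J) c
  downCell (_ , 2≤c , le) J = 1≤target J , 2≤c , ≤-trans (<⇒≤ (downLowers J)) le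

  Stops : ℕ → ℕ → ℕ → Set
  Stops r c i = K <ₖ L (r ∸ i) (c + i) ⊎ L (r ∸ i) (c + i) ≡ fin K ⊎ L (r ∸ i) (c + i) ≡ fin 0

  stops? : ∀ r c i → Dec (Stops r c i)
  stops? r c i = (fin K <ᴱ? e) ⊎-dec ((e ≟ᴱ fin K) ⊎-dec (e ≟ᴱ fin 0))
    where e = L (r ∸ i) (c + i)

  record DiagJump (r c : ℕ) : Set where
    constructor diagTo
    field
      offset   : ℕ
      1≤offset : 1 ≤ offset
      offset<r : offset < r
      stops    : Stops r c offset
      passed   : ∀ i → 1 ≤ i → i < offset → ¬ Stops r c i
  open DiagJump

  -- the diagonal jump exists: it stops at the latest on the 0 of row 1
  diagJump : ∀ {r c n} → Cell r c → L r c ≡ fin (suc n) → DiagJump r c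
  diagJump {suc zero} cell key with trans (sym key) (bottomOf cell)
  ... | ()
  diagJump {suc (suc r)} {c} cell _
    with leastWitness (Stops (suc (suc r)) c ∘ suc) (stops? (suc (suc r)) c ∘ suc) r stopsInRow1
    where
    tailRow : suc r ∸ r ≡ 1
    tailRow = trans (cong (_∸ r) (+-comm 1 r)) (m+n∸m≡n r 1)
    stopsInRow1 : Stops (suc (suc r)) c (suc r)
    stopsInRow1 = inj₂ (inj₂ (trans (cong (λ row → L row (c + suc r)) tailRow)
                                    (bottomOf (alongDiagonal cell (≤-refl {suc (suc r)})))))
  ... | k , k≤r , stopsAtK , before = diagTo (suc k) (s≤s z≤n) (s≤s (s≤s k≤r)) stopsAtK passedBefore
    where
    passedBefore : ∀ i → 1 ≤ i → i < suc k → ¬ Stops (suc (suc r)) c i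
    passedBefore (suc i) _ (s≤s i<k) = before i i<k

  record Terminates (r c k : ℕ) : Set where
    constructor halts
    field
      time   : ℕ
      run    : Run T L K r c time
      within : time ≤ k * U

  halt : ∀ {r c k} → Run T L K r c 1 → Terminates r c (suc k)
  halt run = halts 1 run (≤-trans (≤-trans (s≤s z≤n) (jumpCost 0 z≤n)) (m≤m+n _ _))

  relax : ∀ {r c k k'} → k ≤ k' → Terminates r c k → Terminates r c k'
  relax k≤k' (halts t run t≤) = halts t run (≤-trans t≤ (*-monoˡ-≤ U k≤k'))

  takeDown : ∀ {r c k} → Cell r c → (K<e : K <ₖ L r c) → (J : DownJump r c) →
             Terminates (target J) c k → Terminates r c (suc k)
  takeDown cell K<e (downTo _ _ t<r lands skips) (halts t run t≤) =
    halts _ (down K<e t<r lands skips run) (+-mono-≤ (jumpCost _ (rowBound cell)) t≤)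

  takeDiag : ∀ {r c n k} → Cell r c → L r c ≡ fin (suc n) → suc n < K → (J : DiagJump r c) →
             Terminates (r ∸ offset J) (c + offset J) k → Terminates r c (suc k)
  takeDiag cell key n<K (diagTo _ 1≤i i<r stop pass) (halts t run t≤) =
    halts _ (diag key n<K 1≤i i<r stop pass run) (+-mono-≤ (jumpCost _ (rowBound cell)) t≤)

  resolveLanding : ∀ {r c k} → L r c ≤ₖ K →
    (∀ {n} → L r c ≡ fin (suc n) → suc n < K → Terminates r c (suc k)) → Terminates r c (suc k)
  resolveLanding {r} {c} lands continue with position K (L r c)
  ... | atZero e  = halt (stop0 e)
  ... | atKey e   = halt (stopK e)
  ... | above K<e = contradiction K<e (notAboveLanded lands)
  ... | below key n<K = continue key n<K

  resolveStop : ∀ {r c k} (J : DiagJump r c) →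
    (K <ₖ L (r ∸ offset J) (c + offset J) → Terminates (r ∸ offset J) (c + offset J) (suc k)) →
    Terminates (r ∸ offset J) (c + offset J) (suc k)
  resolveStop J continue with stops J
  ... | inj₁ K<e       = continue K<e
  ... | inj₂ (inj₁ e) = halt (stopK e)
  ... | inj₂ (inj₂ e) = halt (stop0 e)

  downThen : ∀ {r c k} → Cell r c → K <ₖ L r c →
    (∀ {r'} → Cell r' c → r' + c < r + c → L r' c ≤ₖ K → Terminates r' c k) → Terminates r c (suc k)
  downThen cell K<e continue = takeDown cell K<e J (continue (downCell cell J) (downLowers J) (landed J))
    where J = downJump cell K<e

  diagThenDown : ∀ {r c n k} → Cell r c → L r c ≡ fin (suc n) → suc n < K →
    (∀ {r' c'} → Cell r' c' → r' + c' < r + c → L r' c' ≤ₖ K → Terminates r' c' k) →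
    Terminates r c (suc (suc k))
  diagThenDown {r} {c} cell key n<K continue =
    takeDiag cell key n<K J (resolveStop J λ K<e → downThen onDiag K<e λ cell' lower →
      continue cell' (<-≤-trans lower (≤-reflexive (diagonalSum r c (<⇒≤ (offset<r J))))))
    where
    J = diagJump cell key
    onDiag = alongDiagonal cell (offset<r J)

  finishAlongDiagonal : ∀ {r c n} → Cell r c → L r c ≡ fin (suc n) → suc n < K →
    (∀ i → 1 ≤ i → i < r → ¬ (K <ₖ L (r ∸ i) (c + i))) → Terminates r c 2
  finishAlongDiagonal cell key n<K clear =
    takeDiag cell key n<K J (resolveStop J λ K<e → contradiction K<e (clear _ (1≤offset J) (offset<r J)))
    where J = diagJump cell key

  module Sorted {α : ℕ} (sorted : AlphaSorted α L) (α≤h : α ≤ h) where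
    open SortedDiagonals isL sorted α≤h

    notAboveLower : ∀ {r c r₀ c₀ n} → Cell r c → Cell r₀ c₀ → r + c < r₀ + c₀ → r₀ + c₀ ≤ α + 3 →
      L r₀ c₀ ≡ fin (suc n) → suc n < K → ¬ (K <ₖ L r c)
    notAboveLower {r} {c} (1≤r , 2≤c , _) (1≤r₀ , 2≤c₀ , _) lower inRegion key n<K K<e
      with lowEntry 1≤r 2≤c (lowerInRegion lower inRegion)
    ... | inj₁ isZero = notAboveZero isZero K<e
    ... | inj₂ p = <ᴱ-irrefl (<ᴱ-trans K<e (<ᴱ-trans smaller (fin<fin n<K)))
      where
      smaller : L r c <ᴱ fin (suc _)
      smaller = subst (L r c <ᴱ_) key (sortedKeys 1≤r 2≤c 1≤r₀ 2≤c₀ lower inRegion p (_ , key))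

    -- a key below K in the sorted region is resolved within 4 jumps:
    -- diagonal, downward, and a final diagonal jump on a lower diagonal
    keyBelowK : ∀ {r c n} → Cell r c → r + c ≤ α + 3 → L r c ≡ fin (suc n) → suc n < K → Terminates r c 4
    keyBelowK {r} {c} cell inRegion key n<K = diagThenDown cell key n<K λ cell' lower lands →
      resolveLanding lands λ key' n'<K → finishAlongDiagonal cell' key' n'<K (clear cell' lower)
      where
      clear : ∀ {r' c'} → Cell r' c' → r' + c' < r + c → ∀ j → 1 ≤ j → j < r' → ¬ (K <ₖ L (r' ∸ j) (c' + j))
      clear {r'} {c'} cell' lower j _ j<r' = notAboveLower (alongDiagonal cell' j<r') cell
        (≤-<-trans (≤-reflexive (diagonalSum r' c' (<⇒≤ j<r'))) lower) inRegion key n<K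

    sortedRegion : ∀ {r c} → Cell r c → r + c ≤ α + 3 → Terminates r c 5
    sortedRegion {r} {c} cell inRegion with position K (L r c)
    ... | atZero e      = halt (stop0 e)
    ... | atKey e       = halt (stopK e)
    ... | below key n<K = relax (n≤1+n 4) (keyBelowK cell inRegion key n<K)
    ... | above K<e     = downThen cell K<e λ cell' lower lands → resolveLanding lands λ key' n'<K →
                            keyBelowK cell' (≤-trans (<⇒≤ lower) inRegion) key' n'<K

    -- above the sorted region every two jumps lower the diagonal
    searchFrom : ∀ d {r c} → Cell r c → r + c ≤ d + (α + 3) → Terminates r c (budget d)
    searchFrom zero cell inRegion = sortedRegion cell inRegion
    searchFrom (suc d) {r} {c} cell le with position K (L r c)
    ... | atZero e      = halt (stop0 e)
    ... | atKey e       = halt (stopK e)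
    ... | above K<e     = relax (n≤1+n _) (downThen cell K<e λ cell' lower _ →
                            searchFrom d cell' (≤-pred (≤-trans lower le)))
    ... | below key n<K = diagThenDown cell key n<K λ cell' lower _ →
                            searchFrom d cell' (≤-pred (≤-trans lower le))

maxBelow : (ℕ → ℕ) → ℕ → ℕ
maxBelow f zero    = 0
maxBelow f (suc n) = f n ⊔ maxBelow f n

maxBelow-bound : ∀ f {n k} → k < n → f k ≤ maxBelow f n
maxBelow-bound f {suc n} {k} (s≤s k≤n) with m≤n⇒m<n∨m≡n k≤n
... | inj₁ k<n  = ≤-trans (maxBelow-bound f k<n) (m≤n⊔m (f n) (maxBelow f n))
... | inj₂ refl = m≤m⊔n (f k) (maxBelow f k)

uniformBound : ∀ f g → (∀ m → 1 ≤ g m) → BigO f g → Σ ℕ λ C → ∀ m → suc (f m) ≤ C * g m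
uniformBound f g pos (C₀ , N , eventually) = suc (B + C₀) , bound
  where
  B = maxBelow f N
  fBound : ∀ m → f m ≤ B + C₀ * g m
  fBound m with m <? N
  ... | yes m<N = ≤-trans (maxBelow-bound f m<N) (m≤m+n B _)
  ... | no  m≮N = ≤-trans (eventually m (≮⇒≥ m≮N)) (m≤n+m _ B)
  bound : ∀ m → suc (f m) ≤ suc (B + C₀) * g m
  bound m = begin
    suc (f m)                  ≤⟨ s≤s (fBound m) ⟩
    1 + (B + C₀ * g m)         ≤⟨ +-mono-≤ (pos m) (+-monoˡ-≤ (C₀ * g m) B≤Bg) ⟩
    g m + (B * g m + C₀ * g m) ≡⟨ cong (g m +_) (sym (*-distribʳ-+ (g m) B C₀)) ⟩
    suc (B + C₀) * g m         ∎
    where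
    open ≤-Reasoning
    B≤Bg : B ≤ B * g m
    B≤Bg = ≤-trans (≤-reflexive (sym (*-identityʳ B))) (*-monoʳ-≤ B (pos m))

totalCost : ∀ {b M} C x → b ≤ 2 * M → b * (C * x) ≤ (2 * C) * (M * x)
totalCost {b} {M} C x b≤2M = ≤-trans (*-monoˡ-≤ (C * x) b≤2M) (≤-reflexive (regroup M C x))
  where
  regroup : ∀ M C x → (2 * M) * (C * x) ≡ (2 * C) * (M * x)
  regroup = solve-∀

corollary4 : (tP T : ℕ → ℕ) →
    (∀ m n → m ≤ n → tP m ≤ tP n) →
    (∀ m → 1 ≤ tP m) →
    BigO T tP →
    Σ ℕ λ C → Σ ℕ λ N →
      ∀ h α (L : Assignment) (K : ℕ) → N ≤ h →
      3 ≤ α → α ≤ h → IsLDS h L → AlphaSorted α L → 1 ≤ K →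
      Σ ℕ λ t → RunsInTime T h L K t ×
        t ≤ C * ((4 ⊔ ((2 * h ∸ 2 * α) + 2)) * tP h)
-- the bound holds for every height (N = 0) and does not need 3 ≤ α
corollary4 tP T mono pos bigO with uniformBound T tP pos bigO
... | C , stepBound = 2 * C , 0 , search
  where
  search : ∀ h α (L : Assignment) (K : ℕ) → 0 ≤ h → 3 ≤ α → α ≤ h → IsLDS h L →
    AlphaSorted α L → 1 ≤ K →
    Σ ℕ λ t → RunsInTime T h L K t × t ≤ (2 * C) * ((4 ⊔ ((2 * h ∸ 2 * α) + 2)) * tP h)
  search h α L K _ _ α≤h isL sorted 1≤K =
    time , run , ≤-trans within (totalCost {M = 4 ⊔ ((2 * h ∸ 2 * α) + 2)} C (tP h) jumps≤)
    where
    -- one jump on at most h cells costs at most C · tP h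
    open JumpSearch T isL 1≤K (C * tP h) (λ m m≤h → ≤-trans (stepBound m) (*-monoʳ-≤ C (mono m h m≤h)))
    open Sorted sorted α≤h
    start : Cell (h + 1) 2
    start = m≤n+m 1 h , ≤-refl , ≤-reflexive (+-assoc h 1 2)
    startDiagonal : h + 1 + 2 ≤ (h ∸ α) + (α + 3)
    startDiagonal = ≤-reflexive (trans (+-assoc h 1 2)
      (trans (cong (_+ 3) (sym (m∸n+n≡m α≤h))) (+-assoc (h ∸ α) α 3)))
    jumps≤ : budget (h ∸ α) ≤ 2 * (4 ⊔ ((2 * h ∸ 2 * α) + 2))
    jumps≤ = subst (λ x → budget (h ∸ α) ≤ 2 * (4 ⊔ (x + 2))) (*-distribˡ-∸ 2 h α) (budget≤ (h ∸ α))
    open Terminates (searchFrom (h ∸ α) start startDiagonal)
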